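{- Let $n, r \geq 1$ and $\ell \in \mathbb{Z}$. Then $\mathcal{S}_{(r,n)}(\ell) \in \mathbb{Z}$ if and only if \[ \sum_{k=0}^{n-1} \binom{r+n}{k} (-\ell)^k \equiv 0 \pmod{\binom{r+n}{r}}. \]
   Context: For integers $n, r \geq 0$, $\mathcal{S}_{(r,n)}(x) = \sum_{k=0}^{n} \binom{n}{k} (-1)^k x^{n-k} \binom{r+k}{r}^{ -1} \in \mathbb{Q}[x]$. -}

module Defs where

open import Data.Nat using (ℕ; zero; suc; _∸_)
open import Data.Nat.Combinatorics using (_C_)
open import Data.Integer as ℤ using (ℤ; +_)
open import Data.Rational as ℚ using (ℚ; 0ℚ; _/_)

sumℚ : ℕ → (ℕ → ℚ) → ℚ
sumℚ zero    f = f 0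
sumℚ (suc n) f = sumℚ n f ℚ.+ f (suc n)

sumℤ : ℕ → (ℕ → ℤ) → ℤ
sumℤ zero    f = f 0
sumℤ (suc n) f = sumℤ n f ℤ.+ f (suc n)

sumℤ< : ℕ → (ℕ → ℤ) → ℤ
sumℤ< zero    f = + 0
sumℤ< (suc n) f = sumℤ n f

-- reciprocal of a natural number in ℚ (only ever applied to binomials
-- C (r + k) r, which are ≥ 1; the value at 0 is irrelevant)
recipℕ : ℕ → ℚ
recipℕ zero    = 0ℚ
recipℕ (suc m) = (+ 1) / suc m

intℚ : ℤ → ℚ
intℚ z = z / 1

S : ℕ → ℕ → ℤ → ℚ
S r n ℓ = sumℚ n (λ k →
  ((+ (n C k) ℤ.* ((ℤ.- + 1) ℤ.^ k) ℤ.* (ℓ ℤ.^ (n ∸ k))) / 1)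
    ℚ.* recipℕ ((r Data.Nat.+ k) C r))

T : ℕ → ℕ → ℤ → ℤ
T r n ℓ = sumℤ< n (λ k → + ((r Data.Nat.+ n) C k) ℤ.* ((ℤ.- ℓ) ℤ.^ k))

-- Write N = r + n and c = C(N, r). Since C(n, k)·C(N, r) = C(N, r + k)·C(r + k, r), every term
-- of c·S_{(r,n)}(ℓ) is an integer, and c·S_{(r,n)}(ℓ) = Σₖ C(N, r + k)(-1)^k ℓ^(n-k). Reversing
-- the order of summation (C(N, r + k) = C(N, n - k)) turns this sum, up to the sign (-1)^n, into
-- Σ_{j ≤ n} C(N, j)(-ℓ)^j, whose last term c·(-ℓ)^n is a multiple of c. Hence S_{(r,n)}(ℓ) is an
-- integer iff c divides c·S_{(r,n)}(ℓ) iff c divides the truncated sum Σ_{j < n} C(N, j)(-ℓ)^j.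
module Submission where

open import Defs
open import Algebra.Bundles using (CommutativeMonoid)
import Algebra.Properties.CommutativeSemigroup as CommutativeSemigroupProperties
open import Data.Nat.Base as ℕ using (ℕ; zero; suc; _+_; _*_; _∸_; _≤_; _≥_; z≤n; _!)
import Data.Nat.Properties as ℕ
open import Data.Nat.Combinatorics using (_C_; nCk≡n!/k![n-k]!; k![n∸k]!∣n!; nCk≡nC[n∸k])
open import Data.Nat.DivMod using (_/_; m/n*n≡m)
open import Data.Integer.Base as ℤ using (ℤ; +_; -1ℤ; _^_)
import Data.Integer.Properties as ℤ
open import Data.Integer.Divisibility using (_∣_)
import Data.Integer.Divisibility.Signed as Signed
open import Data.Integer.Tactic.RingSolver using (solve-∀)
open import Data.Rational.Base as ℚ using (ℚ; 1ℚ; toℚᵘ)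
import Data.Rational.Properties as ℚ
open import Data.Rational.Unnormalised.Base as ℚᵘ using (mkℚᵘ; *≡*) renaming (_≃_ to _≃ᵘ_)
import Data.Rational.Unnormalised.Properties as ℚᵘ
import Relation.Binary.Reasoning.Setoid ℚᵘ.≃-setoid as ≃ᵘ-Reasoning
open import Data.Product.Base using (∃; _,_)
open import Function.Base using (_∘_)
open import Function.Bundles using (_⇔_; mk⇔)
open import Function.Properties.Equivalence using () renaming (trans to ⇔-trans)
open import Relation.Binary.PropositionalEquality

nCk*k!*m!≡n! : ∀ {n} k m → k + m ≡ n → (n C k) * (k ! * m !) ≡ n !
nCk*k!*m!≡n! k m refl = begin
  ((k + m) C k) * (k ! * m !)             ≡⟨ cong (λ j → ((k + m) C k) * (k ! * j !)) (ℕ.m+n∸m≡n k m) ⟨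
  ((k + m) C k) * (k ! * (k + m ∸ k) !)   ≡⟨ cong (_* (k ! * (k + m ∸ k) !)) (nCk≡n!/k![n-k]! k≤k+m) ⟩
  (k + m) ! / (k ! * (k + m ∸ k) !) * _   ≡⟨ m/n*n≡m (k![n∸k]!∣n! k≤k+m) ⟩
  (k + m) !                               ∎
  where
  open ≡-Reasoning
  k≤k+m = ℕ.m≤m+n k m
  instance _ = k ℕ.!* (k + m ∸ k) !≢0

nCk-nonZero : ∀ {n k} → k ≤ n → ℕ.NonZero (n C k)
nCk-nonZero {n} {k} k≤n = ℕ.≢-nonZero λ nCk≡0 → ℕ.≢-nonZero⁻¹ (n !) {{n ℕ.!≢0}} (begin
  n !                          ≡⟨ nCk*k!*m!≡n! k (n ∸ k) (ℕ.m+[n∸m]≡n k≤n) ⟨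
  (n C k) * (k ! * (n ∸ k) !)  ≡⟨ cong (_* (k ! * (n ∸ k) !)) nCk≡0 ⟩
  0                            ∎)
  where open ≡-Reasoning

[k+j]Ck*[r+k+j]Cr≡[r+k+j]C[r+k]*[r+k]Cr : ∀ r k j →
  ((k + j) C k) * ((r + (k + j)) C r) ≡ ((r + (k + j)) C (r + k)) * ((r + k) C r)
[k+j]Ck*[r+k+j]Cr≡[r+k+j]C[r+k]*[r+k]Cr r k j = ℕ.*-cancelʳ-≡ _ _ (r ! * (k ! * j !)) (begin
    A * B * (r ! * (k ! * j !))    ≡⟨ xy∙z≈y∙xz A B _ ⟩
    B * (A * (r ! * (k ! * j !)))  ≡⟨ cong (B *_) (x∙yz≈y∙xz A (r !) _) ⟩
    B * (r ! * (A * (k ! * j !)))  ≡⟨ cong (λ t → B * (r ! * t)) (nCk*k!*m!≡n! k j refl) ⟩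
    B * (r ! * (k + j) !)          ≡⟨ nCk*k!*m!≡n! r (k + j) refl ⟩
    (r + (k + j)) !                ≡⟨ nCk*k!*m!≡n! (r + k) j (ℕ.+-assoc r k j) ⟨
    D * ((r + k) ! * j !)          ≡⟨ cong (λ t → D * (t * j !)) (nCk*k!*m!≡n! r k refl) ⟨
    D * (E * (r ! * k !) * j !)    ≡⟨ cong (D *_) (ℕ.*-assoc E _ (j !)) ⟩
    D * (E * (r ! * k ! * j !))    ≡⟨ cong (λ t → D * (E * t)) (ℕ.*-assoc (r !) (k !) (j !)) ⟩
    D * (E * (r ! * (k ! * j !)))  ≡⟨ ℕ.*-assoc D E _ ⟨
    D * E * (r ! * (k ! * j !))    ∎)
  where
  open ≡-Reasoning
  open CommutativeSemigroupProperties ℕ.*-commutativeSemigroup using (xy∙z≈y∙xz; x∙yz≈y∙xz)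
  A = (k + j) C k
  B = (r + (k + j)) C r
  D = (r + (k + j)) C (r + k)
  E = (r + k) C r
  instance
    _ = ℕ.m*n≢0 (r !) (k ! * j !) {{r ℕ.!≢0}} {{k ℕ.!* j !≢0}}

nCk*[r+n]Cr≡[r+n]C[r+k]*[r+k]Cr : ∀ r {n k} → k ≤ n →
  (n C k) * ((r + n) C r) ≡ ((r + n) C (r + k)) * ((r + k) C r)
nCk*[r+n]Cr≡[r+n]C[r+k]*[r+k]Cr r {n} {k} k≤n =
  subst (λ n → (n C k) * ((r + n) C r) ≡ ((r + n) C (r + k)) * ((r + k) C r))
        (ℕ.m+[n∸m]≡n k≤n) ([k+j]Ck*[r+k+j]Cr≡[r+k+j]C[r+k]*[r+k]Cr r k (n ∸ k))

[r+n]C[n∸k]≡[r+n]C[r+k] : ∀ r {n k} → k ≤ n → (r + n) C (n ∸ k) ≡ (r + n) C (r + k)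
[r+n]C[n∸k]≡[r+n]C[r+k] r {n} {k} k≤n = begin
  (r + n) C (n ∸ k)                ≡⟨ nCk≡nC[n∸k] (ℕ.≤-trans n∸k≤n (ℕ.m≤n+m n r)) ⟩
  (r + n) C (r + n ∸ (n ∸ k))      ≡⟨ cong ((r + n) C_) (ℕ.+-∸-assoc r n∸k≤n) ⟩
  (r + n) C (r + (n ∸ (n ∸ k)))    ≡⟨ cong (λ i → (r + n) C (r + i)) (ℕ.m∸[m∸n]≡n k≤n) ⟩
  (r + n) C (r + k)                ∎
  where
  open ≡-Reasoning
  n∸k≤n = ℕ.m∸n≤m n k

-1^_ : ℕ → ℤ
-1^ k = -1ℤ ^ k

-1^k*-1^k≡1 : ∀ k → -1^ k ℤ.* -1^ k ≡ + 1
-1^k*-1^k≡1 zero    = refl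
-1^k*-1^k≡1 (suc k) = trans (negate-square (-1^ k)) (-1^k*-1^k≡1 k)
  where
  negate-square : ∀ x → (-1ℤ ℤ.* x) ℤ.* (-1ℤ ℤ.* x) ≡ x ℤ.* x
  negate-square = solve-∀

-1^[n∸k]≡-1^k*-1^n : ∀ {n k} → k ≤ n → -1^ (n ∸ k) ≡ -1^ k ℤ.* -1^ n
-1^[n∸k]≡-1^k*-1^n {n} {k} k≤n = begin
  -1^ (n ∸ k)                          ≡⟨ ℤ.*-identityʳ _ ⟨
  -1^ (n ∸ k) ℤ.* + 1                  ≡⟨ cong (-1^ (n ∸ k) ℤ.*_) (-1^k*-1^k≡1 k) ⟨
  -1^ (n ∸ k) ℤ.* (-1^ k ℤ.* -1^ k)    ≡⟨ ℤ.*-assoc (-1^ (n ∸ k)) (-1^ k) (-1^ k) ⟨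
  -1^ (n ∸ k) ℤ.* -1^ k ℤ.* -1^ k      ≡⟨ cong (ℤ._* -1^ k) (ℤ.^-distribˡ-+-* -1ℤ (n ∸ k) k) ⟨
  -1^ (n ∸ k + k) ℤ.* -1^ k            ≡⟨ cong (λ i → -1^ i ℤ.* -1^ k) (ℕ.m∸n+n≡m k≤n) ⟩
  -1^ n ℤ.* -1^ k                      ≡⟨ ℤ.*-comm (-1^ n) (-1^ k) ⟩
  -1^ k ℤ.* -1^ n                      ∎
  where open ≡-Reasoning

[-i]^k≡-1^k*i^k : ∀ i k → (ℤ.- i) ^ k ≡ -1^ k ℤ.* i ^ k
[-i]^k≡-1^k*i^k i zero    = refl
[-i]^k≡-1^k*i^k i (suc k) = trans (cong (ℤ.- i ℤ.*_) ([-i]^k≡-1^k*i^k i k)) (regroup i (-1^ k) (i ^ k))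
  where
  regroup : ∀ i s p → ℤ.- i ℤ.* (s ℤ.* p) ≡ (-1ℤ ℤ.* s) ℤ.* (i ℤ.* p)
  regroup = solve-∀

sumℤ-cong : ∀ n {f g : ℕ → ℤ} → (∀ {k} → k ≤ n → f k ≡ g k) → sumℤ n f ≡ sumℤ n g
sumℤ-cong zero    f≗g = f≗g z≤n
sumℤ-cong (suc n) f≗g = cong₂ ℤ._+_ (sumℤ-cong n (f≗g ∘ ℕ.m≤n⇒m≤1+n)) (f≗g ℕ.≤-refl)

sumℤ-*ʳ : ∀ n (f : ℕ → ℤ) x → sumℤ n f ℤ.* x ≡ sumℤ n (λ k → f k ℤ.* x)
sumℤ-*ʳ zero    f x = refl
sumℤ-*ʳ (suc n) f x =
  trans (ℤ.*-distribʳ-+ x (sumℤ n f) (f (suc n))) (cong (ℤ._+ f (suc n) ℤ.* x) (sumℤ-*ʳ n f x))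

sumℤ-suc : ∀ n (f : ℕ → ℤ) → sumℤ (suc n) f ≡ f 0 ℤ.+ sumℤ n (f ∘ suc)
sumℤ-suc zero    f = refl
sumℤ-suc (suc n) f = trans (cong (ℤ._+ f (suc (suc n))) (sumℤ-suc n f)) (ℤ.+-assoc (f 0) _ _)

sumℤ-reverse : ∀ n (f : ℕ → ℤ) → sumℤ n f ≡ sumℤ n (λ k → f (n ∸ k))
sumℤ-reverse zero    f = refl
sumℤ-reverse (suc n) f = begin
  sumℤ n f ℤ.+ f (suc n)                        ≡⟨ cong (ℤ._+ f (suc n)) (sumℤ-reverse n f) ⟩
  sumℤ n (λ k → f (n ∸ k)) ℤ.+ f (suc n)        ≡⟨ ℤ.+-comm _ (f (suc n)) ⟩
  f (suc n) ℤ.+ sumℤ n (λ k → f (n ∸ k))        ≡⟨ sumℤ-suc n (λ k → f (suc n ∸ k)) ⟨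
  sumℤ (suc n) (λ k → f (suc n ∸ k))            ∎
  where open ≡-Reasoning

sumℤ≡sumℤ<+last : ∀ n (f : ℕ → ℤ) → sumℤ n f ≡ sumℤ< n f ℤ.+ f n
sumℤ≡sumℤ<+last zero    f = sym (ℤ.+-identityˡ (f 0))
sumℤ≡sumℤ<+last (suc n) f = refl

sumℚ-cong : ∀ n {f g : ℕ → ℚ} → (∀ {k} → k ≤ n → f k ≡ g k) → sumℚ n f ≡ sumℚ n g
sumℚ-cong zero    f≗g = f≗g z≤n
sumℚ-cong (suc n) f≗g = cong₂ ℚ._+_ (sumℚ-cong n (f≗g ∘ ℕ.m≤n⇒m≤1+n)) (f≗g ℕ.≤-refl)

sumℚ-*ʳ : ∀ n (f : ℕ → ℚ) x → sumℚ n f ℚ.* x ≡ sumℚ n (λ k → f k ℚ.* x)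
sumℚ-*ʳ zero    f x = refl
sumℚ-*ʳ (suc n) f x =
  trans (ℚ.*-distribʳ-+ x (sumℚ n f) (f (suc n))) (cong (ℚ._+ f (suc n) ℚ.* x) (sumℚ-*ʳ n f x))

toℚᵘ-intℚ : ∀ z → toℚᵘ (intℚ z) ≃ᵘ mkℚᵘ z 0
toℚᵘ-intℚ z = ℚ.toℚᵘ-fromℚᵘ (mkℚᵘ z 0)

intℚ-injective : ∀ {a b} → intℚ a ≡ intℚ b → a ≡ b
intℚ-injective {a} {b} intℚa≡intℚb
  with ℚᵘ.≃-trans (ℚᵘ.≃-sym (toℚᵘ-intℚ a)) (ℚᵘ.≃-trans (ℚ.toℚᵘ-cong intℚa≡intℚb) (toℚᵘ-intℚ b))
... | *≡* a*1≡b*1 = trans (sym (ℤ.*-identityʳ a)) (trans a*1≡b*1 (ℤ.*-identityʳ b))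

intℚ-+ : ∀ a b → intℚ (a ℤ.+ b) ≡ intℚ a ℚ.+ intℚ b
intℚ-+ a b = ℚ.toℚᵘ-injective (begin
  toℚᵘ (intℚ (a ℤ.+ b))                ≈⟨ toℚᵘ-intℚ (a ℤ.+ b) ⟩
  mkℚᵘ (a ℤ.+ b) 0                     ≈⟨ *≡* (cross-multiply a b) ⟩
  mkℚᵘ a 0 ℚᵘ.+ mkℚᵘ b 0               ≈⟨ ℚᵘ.+-cong (toℚᵘ-intℚ a) (toℚᵘ-intℚ b) ⟨
  toℚᵘ (intℚ a) ℚᵘ.+ toℚᵘ (intℚ b)     ≈⟨ ℚ.toℚᵘ-homo-+ (intℚ a) (intℚ b) ⟨
  toℚᵘ (intℚ a ℚ.+ intℚ b)             ∎)
  where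
  open ≃ᵘ-Reasoning
  cross-multiply : ∀ a b → (a ℤ.+ b) ℤ.* + 1 ≡ (a ℤ.* + 1 ℤ.+ b ℤ.* + 1) ℤ.* + 1
  cross-multiply = solve-∀

intℚ-* : ∀ a b → intℚ (a ℤ.* b) ≡ intℚ a ℚ.* intℚ b
intℚ-* a b = ℚ.toℚᵘ-injective (begin
  toℚᵘ (intℚ (a ℤ.* b))                ≈⟨ toℚᵘ-intℚ (a ℤ.* b) ⟩
  mkℚᵘ (a ℤ.* b) 0                     ≈⟨ ℚᵘ.≃-refl ⟩
  mkℚᵘ a 0 ℚᵘ.* mkℚᵘ b 0               ≈⟨ ℚᵘ.*-cong (toℚᵘ-intℚ a) (toℚᵘ-intℚ b) ⟨
  toℚᵘ (intℚ a) ℚᵘ.* toℚᵘ (intℚ b)     ≈⟨ ℚ.toℚᵘ-homo-* (intℚ a) (intℚ b) ⟨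
  toℚᵘ (intℚ a ℚ.* intℚ b)             ∎)
  where open ≃ᵘ-Reasoning

intℚ*recipℕ≡1 : ∀ d .{{_ : ℕ.NonZero d}} → intℚ (+ d) ℚ.* recipℕ d ≡ 1ℚ
intℚ*recipℕ≡1 d@(suc d-1) = ℚ.toℚᵘ-injective (begin
  toℚᵘ (intℚ (+ d) ℚ.* recipℕ d)               ≈⟨ ℚ.toℚᵘ-homo-* (intℚ (+ d)) (recipℕ d) ⟩
  toℚᵘ (intℚ (+ d)) ℚᵘ.* toℚᵘ (recipℕ d)       ≈⟨ ℚᵘ.*-cong (toℚᵘ-intℚ (+ d)) (ℚ.toℚᵘ-fromℚᵘ (mkℚᵘ (+ 1) d-1)) ⟩
  mkℚᵘ (+ d) 0 ℚᵘ.* mkℚᵘ (+ 1) d-1             ≈⟨ *≡* (cross-multiply (+ d)) ⟩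
  toℚᵘ 1ℚ                                      ∎)
  where
  open ≃ᵘ-Reasoning
  cross-multiply : ∀ x → x ℤ.* + 1 ℤ.* + 1 ≡ + 1 ℤ.* (+ 1 ℤ.* x)
  cross-multiply = solve-∀

intℚ-sumℤ : ∀ n (f : ℕ → ℤ) → intℚ (sumℤ n f) ≡ sumℚ n (intℚ ∘ f)
intℚ-sumℤ zero    f = refl
intℚ-sumℤ (suc n) f = trans (intℚ-+ (sumℤ n f) (f (suc n))) (cong (ℚ._+ intℚ (f (suc n))) (intℚ-sumℤ n f))

*-intℚ-recipℕ-cancelʳ : ∀ p d .{{_ : ℕ.NonZero d}} → p ℚ.* intℚ (+ d) ℚ.* recipℕ d ≡ p
*-intℚ-recipℕ-cancelʳ p d = begin
  p ℚ.* intℚ (+ d) ℚ.* recipℕ d      ≡⟨ ℚ.*-assoc p (intℚ (+ d)) (recipℕ d) ⟩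
  p ℚ.* (intℚ (+ d) ℚ.* recipℕ d)    ≡⟨ cong (p ℚ.*_) (intℚ*recipℕ≡1 d) ⟩
  p ℚ.* 1ℚ                           ≡⟨ ℚ.*-identityʳ p ⟩
  p                                  ∎
  where open ≡-Reasoning

[a/d]*c≡b : ∀ a b c d .{{_ : ℕ.NonZero d}} → a ℤ.* + c ≡ b ℤ.* + d →
  intℚ a ℚ.* recipℕ d ℚ.* intℚ (+ c) ≡ intℚ b
[a/d]*c≡b a b c d a*c≡b*d = begin
  intℚ a ℚ.* recipℕ d ℚ.* intℚ (+ c)   ≡⟨ xy∙z≈xz∙y (intℚ a) (recipℕ d) (intℚ (+ c)) ⟩
  intℚ a ℚ.* intℚ (+ c) ℚ.* recipℕ d   ≡⟨ cong (ℚ._* recipℕ d) (intℚ-* a (+ c)) ⟨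
  intℚ (a ℤ.* + c) ℚ.* recipℕ d        ≡⟨ cong (λ z → intℚ z ℚ.* recipℕ d) a*c≡b*d ⟩
  intℚ (b ℤ.* + d) ℚ.* recipℕ d        ≡⟨ cong (ℚ._* recipℕ d) (intℚ-* b (+ d)) ⟩
  intℚ b ℚ.* intℚ (+ d) ℚ.* recipℕ d   ≡⟨ *-intℚ-recipℕ-cancelʳ (intℚ b) d ⟩
  intℚ b                               ∎
  where
  open ≡-Reasoning
  open CommutativeSemigroupProperties (CommutativeMonoid.commutativeSemigroup ℚ.*-1-commutativeMonoid) using (xy∙z≈xz∙y)

integral⇔∣ : ∀ q p c .{{_ : ℕ.NonZero c}} → q ℚ.* intℚ (+ c) ≡ intℚ p →
  (∃ λ z → q ≡ intℚ z) ⇔ (+ c Signed.∣ p)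
integral⇔∣ q p c q*c≡p = mk⇔ integral⇒∣ ∣⇒integral
  where
  open ≡-Reasoning
  integral⇒∣ : (∃ λ z → q ≡ intℚ z) → + c Signed.∣ p
  integral⇒∣ (z , q≡z) = Signed.divides z (intℚ-injective (begin
    intℚ p                    ≡⟨ q*c≡p ⟨
    q ℚ.* intℚ (+ c)          ≡⟨ cong (ℚ._* intℚ (+ c)) q≡z ⟩
    intℚ z ℚ.* intℚ (+ c)     ≡⟨ intℚ-* z (+ c) ⟨
    intℚ (z ℤ.* + c)          ∎))
  ∣⇒integral : + c Signed.∣ p → ∃ λ z → q ≡ intℚ z
  ∣⇒integral (Signed.divides z p≡z*c) = z , (begin
    q                                     ≡⟨ *-intℚ-recipℕ-cancelʳ q c ⟨
    q ℚ.* intℚ (+ c) ℚ.* recipℕ c         ≡⟨ cong (ℚ._* recipℕ c) (trans q*c≡p (cong intℚ p≡z*c)) ⟩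
    intℚ (z ℤ.* + c) ℚ.* recipℕ c         ≡⟨ cong (ℚ._* recipℕ c) (intℚ-* z (+ c)) ⟩
    intℚ z ℚ.* intℚ (+ c) ℚ.* recipℕ c    ≡⟨ *-intℚ-recipℕ-cancelʳ (intℚ z) c ⟩
    intℚ z                                ∎)

p*s≡t+c*x⇒c∣p⇔c∣t : ∀ {c p t x s} → s ℤ.* s ≡ + 1 → p ℤ.* s ≡ t ℤ.+ c ℤ.* x →
  c Signed.∣ p ⇔ c Signed.∣ t
p*s≡t+c*x⇒c∣p⇔c∣t {c} {p} {t} {x} {s} s*s≡1 p*s≡t+c*x = mk⇔ ∣p⇒∣t ∣t⇒∣p
  where
  c∣c*x : c Signed.∣ c ℤ.* x
  c∣c*x = Signed.∣m⇒∣m*n x Signed.∣-refl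
  ∣p⇒∣t : c Signed.∣ p → c Signed.∣ t
  ∣p⇒∣t c∣p = Signed.∣m+n∣n⇒∣m (subst (c Signed.∣_) p*s≡t+c*x (Signed.∣m⇒∣m*n s c∣p)) c∣c*x
  p*s*s≡p : p ℤ.* s ℤ.* s ≡ p
  p*s*s≡p = trans (ℤ.*-assoc p s s) (trans (cong (p ℤ.*_) s*s≡1) (ℤ.*-identityʳ p))
  ∣t⇒∣p : c Signed.∣ t → c Signed.∣ p
  ∣t⇒∣p c∣t = subst (c Signed.∣_) p*s*s≡p
    (Signed.∣m⇒∣m*n s (subst (c Signed.∣_) (sym p*s≡t+c*x) (Signed.∣m∣n⇒∣m+n c∣t c∣c*x)))

scaledS : ℕ → ℕ → ℤ → ℤ
scaledS r n ℓ = sumℤ n (λ k → + ((r + n) C (r + k)) ℤ.* -1^ k ℤ.* ℓ ^ (n ∸ k))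

S*[r+n]Cr≡scaledS : ∀ r n ℓ → S r n ℓ ℚ.* intℚ (+ ((r + n) C r)) ≡ intℚ (scaledS r n ℓ)
S*[r+n]Cr≡scaledS r n ℓ = begin
  S r n ℓ ℚ.* intℚ (+ c)
    ≡⟨ sumℚ-*ʳ n (λ k → intℚ (F k) ℚ.* recipℕ (d k)) (intℚ (+ c)) ⟩
  sumℚ n (λ k → intℚ (F k) ℚ.* recipℕ (d k) ℚ.* intℚ (+ c))
    ≡⟨ sumℚ-cong n term ⟩
  sumℚ n (intℚ ∘ G)
    ≡⟨ intℚ-sumℤ n G ⟨
  intℚ (scaledS r n ℓ)
    ∎
  where
  open ≡-Reasoning
  c = (r + n) C r
  d : ℕ → ℕ
  d k = (r + k) C r
  F G : ℕ → ℤ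
  F k = + (n C k) ℤ.* -1^ k ℤ.* ℓ ^ (n ∸ k)
  G k = + ((r + n) C (r + k)) ℤ.* -1^ k ℤ.* ℓ ^ (n ∸ k)
  regroup : ∀ a s L x → a ℤ.* s ℤ.* L ℤ.* x ≡ a ℤ.* x ℤ.* s ℤ.* L
  regroup = solve-∀
  term : ∀ {k} → k ≤ n → intℚ (F k) ℚ.* recipℕ (d k) ℚ.* intℚ (+ c) ≡ intℚ (G k)
  term {k} k≤n = [a/d]*c≡b (F k) (G k) c (d k) {{nCk-nonZero (ℕ.m≤m+n r k)}} (begin
    F k ℤ.* + c                                        ≡⟨ regroup (+ (n C k)) s L (+ c) ⟩
    + (n C k) ℤ.* + c ℤ.* s ℤ.* L                      ≡⟨ cong (λ z → z ℤ.* s ℤ.* L) binomials ⟩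
    + ((r + n) C (r + k)) ℤ.* + d k ℤ.* s ℤ.* L        ≡⟨ regroup (+ ((r + n) C (r + k))) s L (+ d k) ⟨
    G k ℤ.* + d k                                      ∎)
    where
    s = -1^ k
    L = ℓ ^ (n ∸ k)
    binomials : + (n C k) ℤ.* + c ≡ + ((r + n) C (r + k)) ℤ.* + d k
    binomials = begin
      + (n C k) ℤ.* + c                 ≡⟨ ℤ.pos-* (n C k) c ⟨
      + ((n C k) * c)                   ≡⟨ cong +_ (nCk*[r+n]Cr≡[r+n]C[r+k]*[r+k]Cr r k≤n) ⟩
      + (((r + n) C (r + k)) * d k)     ≡⟨ ℤ.pos-* ((r + n) C (r + k)) (d k) ⟩
      + ((r + n) C (r + k)) ℤ.* + d k   ∎

scaledS*-1^n≡T+[r+n]Cr*[-ℓ]^n : ∀ r n ℓ →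
  scaledS r n ℓ ℤ.* -1^ n ≡ T r n ℓ ℤ.+ + ((r + n) C r) ℤ.* (ℤ.- ℓ) ^ n
scaledS*-1^n≡T+[r+n]Cr*[-ℓ]^n r n ℓ = begin
  scaledS r n ℓ ℤ.* -1^ n                  ≡⟨ sumℤ-*ʳ n G (-1^ n) ⟩
  sumℤ n (λ k → G k ℤ.* -1^ n)             ≡⟨ sumℤ-cong n H[n∸k]≡G[k]*-1^n ⟨
  sumℤ n (λ k → H (n ∸ k))                 ≡⟨ sumℤ-reverse n H ⟨
  sumℤ n H                                 ≡⟨ sumℤ≡sumℤ<+last n H ⟩
  T r n ℓ ℤ.+ H n                          ≡⟨ cong (λ i → T r n ℓ ℤ.+ + i ℤ.* (ℤ.- ℓ) ^ n) [r+n]Cn≡[r+n]Cr ⟩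
  T r n ℓ ℤ.+ + ((r + n) C r) ℤ.* (ℤ.- ℓ) ^ n   ∎
  where
  open ≡-Reasoning
  G H : ℕ → ℤ
  G k = + ((r + n) C (r + k)) ℤ.* -1^ k ℤ.* ℓ ^ (n ∸ k)
  H j = + ((r + n) C j) ℤ.* (ℤ.- ℓ) ^ j
  [r+n]Cn≡[r+n]Cr : (r + n) C n ≡ (r + n) C r
  [r+n]Cn≡[r+n]Cr = trans (nCk≡nC[n∸k] (ℕ.m≤n+m n r)) (cong ((r + n) C_) (ℕ.m+n∸n≡m r n))
  regroup : ∀ a s t L → a ℤ.* (s ℤ.* t ℤ.* L) ≡ a ℤ.* s ℤ.* L ℤ.* t
  regroup = solve-∀
  H[n∸k]≡G[k]*-1^n : ∀ {k} → k ≤ n → H (n ∸ k) ≡ G k ℤ.* -1^ n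
  H[n∸k]≡G[k]*-1^n {k} k≤n = begin
    + ((r + n) C (n ∸ k)) ℤ.* (ℤ.- ℓ) ^ (n ∸ k)
      ≡⟨ cong₂ ℤ._*_ (cong +_ ([r+n]C[n∸k]≡[r+n]C[r+k] r k≤n)) ([-i]^k≡-1^k*i^k ℓ (n ∸ k)) ⟩
    + ((r + n) C (r + k)) ℤ.* (-1^ (n ∸ k) ℤ.* ℓ ^ (n ∸ k))
      ≡⟨ cong (λ s → + ((r + n) C (r + k)) ℤ.* (s ℤ.* ℓ ^ (n ∸ k))) (-1^[n∸k]≡-1^k*-1^n k≤n) ⟩
    + ((r + n) C (r + k)) ℤ.* (-1^ k ℤ.* -1^ n ℤ.* ℓ ^ (n ∸ k))
      ≡⟨ regroup (+ ((r + n) C (r + k))) (-1^ k) (-1^ n) (ℓ ^ (n ∸ k)) ⟩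
    G k ℤ.* -1^ n
      ∎

proposition3p1 : (n r : ℕ) → n ≥ 1 → r ≥ 1 → (ℓ : ℤ) →
    (∃ λ (z : ℤ) → S r n ℓ ≡ intℚ z) ⇔ ((+ ((r + n) C r)) ∣ T r n ℓ)
proposition3p1 n r _ _ ℓ =
  ⇔-trans (integral⇔∣ (S r n ℓ) (scaledS r n ℓ) c (S*[r+n]Cr≡scaledS r n ℓ))
  (⇔-trans (p*s≡t+c*x⇒c∣p⇔c∣t (-1^k*-1^k≡1 n) (scaledS*-1^n≡T+[r+n]Cr*[-ℓ]^n r n ℓ))
           (mk⇔ (Signed.∣⇒∣ᵤ {i = T r n ℓ}) Signed.∣ᵤ⇒∣))
  where
  c = (r + n) C r
  instance _ = nCk-nonZero (ℕ.m≤m+n r n)
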